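{- Let $q$ be a power of two, $A$ a $q$-modular witness in a graph $G$, and write $\deg_A(v)\equiv d+qb_A(v)\pmod{2q}$ on $A$, where $d$ is a lift modulo $2q$ of the common residue modulo $q$ and $b_A(v)\in\{0,1\}$. Let $U\subseteq A$, $D=A\setminus U$, and suppose $D$ is partitioned into blocks $P_1,\dots,P_t$, each of size $q$, such that all vertices of $P_i$ have the same trace $B_i=N(x)\cap U$ on $U$. If $b_A|_U-\sum_{i=1}^t\mathbf 1_{B_i}$ is constant modulo $2$ on $U$, equivalently $[b_A|_U]=\sum_{i=1}^t[\mathbf 1_{B_i}]$ in $\mathbb F_2^U/\langle\mathbf 1_U\rangle$, then $U$ is $2q$-modular. In particular, if $|U|\le2q$, then $G[U]$ is regular.
   Context: Graphs are finite simple; $\deg_S(v)$ is the degree of $v$ in $G[S]$; $S$ is $q$-modular if all $\deg_S(v)$, $v\in S$, are congruent modulo $q$. $\mathbf 1_B$ is the indicator vector of $B$; the quotient is by constant vectors. -}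

module Defs where

open import Data.Nat using (ℕ; _+_; _*_; _^_; ∣_-_∣)
open import Data.Nat.Divisibility using (_∣_)
open import Data.Bool using (Bool; true; false)
open import Data.Fin using (Fin)
open import Data.Fin.Subset using (Subset; _∈_; _∩_; ∣_∣)
open import Data.Vec using (tabulate)
open import Relation.Binary.PropositionalEquality using (_≡_)
open import Relation.Nullary using (¬_)

record Graph (n : ℕ) : Set where
  field
    Adj    : Fin n → Fin n → Bool
    sym    : ∀ u v → Adj u v ≡ Adj v u
    irrefl : ∀ v → Adj v v ≡ false
open Graph public

N : ∀ {n} → Graph n → Fin n → Subset n
N G v = tabulate (Adj G v)

deg : ∀ {n} → Graph n → Subset n → Fin n → ℕ
deg G S v = ∣ N G v ∩ S ∣

infix 4 _≡_[mod_]
_≡_[mod_] : ℕ → ℕ → ℕ → Set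
a ≡ b [mod m ] = m ∣ ∣ a - b ∣

Modular : ∀ {n} → Graph n → ℕ → Subset n → Set
Modular G m S = ∀ u v → u ∈ S → v ∈ S → deg G S u ≡ deg G S v [mod m ]

Regular : ∀ {n} → Graph n → Subset n → Set
Regular G S = ∀ u v → u ∈ S → v ∈ S → deg G S u ≡ deg G S v

countIn : ∀ {n t} → (Fin t → Subset n) → Fin n → ℕ
countIn B u = ∣ tabulate (λ i → Data.Vec.lookup (B i) u) ∣

-- A vertex u ∈ U sees a block P_i either entirely (u ∈ B_i) or not at all, so
-- deg_A(u) = deg_U(u) + q·#{i : u ∈ B_i}.  Modulo 2q the term q·x only depends
-- on x mod 2, hence deg_U(u) ≡ d + q·(b_A(u) + #{i : u ∈ B_i}) ≡ d + q·c for a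
-- constant c.  Degrees inside G[U] are smaller than |U|, so for |U| ≤ 2q this
-- congruence becomes an equality.
module Submission where

open import Defs
open import Data.Nat using (ℕ; _+_; _*_; _^_; _≤_; _<_)
open import Data.Fin using (Fin)
open import Data.Fin.Subset using (Subset; _∈_; _∉_; _⊆_; ∣_∣)
open import Data.Product using (Σ; ∃; _×_)
open import Data.Bool using (true)
open import Relation.Binary.PropositionalEquality using (_≡_; _≢_)
open import Function.Bundles using (_⇔_)
open import Data.Empty using (⊥)

open import Data.Nat using (zero; suc; _∸_; _%_; _/_; ∣_-_∣; NonZero)
open import Data.Nat.Properties
  using ( +-*-semiring; +-comm; +-identityʳ; *-comm; ≤-total; ≤-trans; ≤-<-trans; ⊔-lub
        ; m+[n∸m]≡n; m^n≢0; m≤n⇒∣m-n∣≡n∸m; ∣-∣-comm; ∣m+n-m+o∣≡∣n-o∣; ∣m-n∣≡0⇒m≡n; ∣m-n∣≤m⊔n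
        ; *-distribˡ-∣-∣; *-distribʳ-∣-∣ )
open import Data.Nat.DivMod using (m≡m%n+[m/n]*n; [m+kn]%n≡m%n; %-distribˡ-+; %-remove-+ʳ)
open import Data.Nat.Divisibility using (_∣_; divides; >⇒∤; *-monoʳ-∣)
open import Data.Nat.Solver using (module +-*-Solver)
open import Data.Bool using (Bool; false; _∧_)
open import Data.Bool.Properties using (∧-zeroʳ)
open import Data.Fin using (zero; suc)
import Data.Fin.Properties as Fin
open import Data.Fin.Subset using (inside; outside; _∩_)
open import Data.Fin.Subset.Properties using (p⊂q⇒∣p∣<∣q∣; p∩q⊆q; x∈p∩q⁻)
open import Data.Vec using ([]; _∷_; lookup; tabulate)
open import Data.Vec.Properties using (lookup∘tabulate; lookup-zipWith; []=⇒lookup; lookup⇒[]=)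
open import Data.Product using (_,_; proj₁; proj₂)
open import Data.Sum using (inj₁; inj₂)
open import Function using (_∘_)
open import Function.Bundles using (module Equivalence)
open import Relation.Nullary using (contradiction)
open import Relation.Binary.PropositionalEquality
  using (refl; trans; cong; cong₂; subst; subst₂; module ≡-Reasoning)
import Relation.Binary.PropositionalEquality as ≡
open import Algebra.Properties.Semiring.Sum +-*-semiring
  using (sum-syntax; sum-cong-≗; sum-replicate-zero; ∑-distrib-+; ∑-comm; *-distribˡ-sum; *-distribʳ-sum)

open Equivalence using (to; from)

private
  variable
    a b m : ℕ

≤∧∣∸⇒%≡ : ∀ m .{{_ : NonZero m}} → a ≤ b → m ∣ b ∸ a → b % m ≡ a % m
≤∧∣∸⇒%≡ {a} {b} m a≤b m∣b∸a = trans (cong (_% m) (≡.sym (m+[n∸m]≡n a≤b))) (%-remove-+ʳ a m∣b∸a)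

≡[mod]⇒%≡ : ∀ m .{{_ : NonZero m}} → a ≡ b [mod m ] → a % m ≡ b % m
≡[mod]⇒%≡ {a} {b} m a≡b with ≤-total a b
... | inj₁ a≤b = ≡.sym (≤∧∣∸⇒%≡ m a≤b (subst (m ∣_) (m≤n⇒∣m-n∣≡n∸m a≤b) a≡b))
... | inj₂ b≤a = ≤∧∣∸⇒%≡ m b≤a (subst (m ∣_) (trans (∣-∣-comm a b) (m≤n⇒∣m-n∣≡n∸m b≤a)) a≡b)

%≡⇒≡[mod] : ∀ m .{{_ : NonZero m}} → a % m ≡ b % m → a ≡ b [mod m ]
%≡⇒≡[mod] {a} {b} m a%m≡b%m = divides ∣ a / m - b / m ∣ (begin
    ∣ a - b ∣                                        ≡⟨ cong₂ ∣_-_∣ (m≡m%n+[m/n]*n a m) (m≡m%n+[m/n]*n b m) ⟩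
    ∣ a % m + (a / m) * m - b % m + (b / m) * m ∣    ≡⟨ cong (λ r → ∣ a % m + (a / m) * m - r + (b / m) * m ∣) (≡.sym a%m≡b%m) ⟩
    ∣ a % m + (a / m) * m - a % m + (b / m) * m ∣    ≡⟨ ∣m+n-m+o∣≡∣n-o∣ (a % m) _ _ ⟩
    ∣ (a / m) * m - (b / m) * m ∣                    ≡⟨ ≡.sym (*-distribʳ-∣-∣ m (a / m) (b / m)) ⟩
    ∣ a / m - b / m ∣ * m                            ∎)
  where open ≡-Reasoning

∣∧<⇒≡0 : ∀ {m n} → m ∣ n → n < m → n ≡ 0
∣∧<⇒≡0 {n = zero}  _   _   = refl
∣∧<⇒≡0 {n = suc n} m∣n n<m = contradiction m∣n (>⇒∤ n<m)

≡[mod]∧<⇒≡ : a < m → b < m → a ≡ b [mod m ] → a ≡ b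
≡[mod]∧<⇒≡ {a} {m} {b} a<m b<m a≡b =
  ∣m-n∣≡0⇒m≡n (∣∧<⇒≡0 a≡b (≤-<-trans (∣m-n∣≤m⊔n a b) (⊔-lub a<m b<m)))

*-cong-≡[mod] : ∀ q → a ≡ b [mod m ] → q * a ≡ q * b [mod m * q ]
*-cong-≡[mod] {a} {b} {m} q a≡b = subst₂ _∣_ (*-comm q m) (*-distribˡ-∣-∣ q a b) (*-monoʳ-∣ q a≡b)

%-+-congˡ : ∀ a {x y} m .{{_ : NonZero m}} → x % m ≡ y % m → (a + x) % m ≡ (a + y) % m
%-+-congˡ a {x} {y} m x≡y = begin
  (a + x) % m              ≡⟨ %-distribˡ-+ a x m ⟩
  (a % m + x % m) % m      ≡⟨ cong (λ r → (a % m + r) % m) x≡y ⟩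
  (a % m + y % m) % m      ≡⟨ %-distribˡ-+ a y m ⟨
  (a + y) % m              ∎
  where open ≡-Reasoning

%-+-congʳ : ∀ a {x y} m .{{_ : NonZero m}} → x % m ≡ y % m → (x + a) % m ≡ (y + a) % m
%-+-congʳ a {x} {y} m x≡y =
  trans (cong (_% m) (+-comm x a)) (trans (%-+-congˡ a m x≡y) (cong (_% m) (+-comm a y)))

-- Adding m·2q ≡ 0 turns e + m·q into d + q·(b + m), and modulo 2q the last
-- summand only depends on b + m modulo 2.
%2q-parity-shift : ∀ q {d b c e m} .{{_ : NonZero (2 * q)}}
  → e + m * q ≡ d + q * b [mod 2 * q ]
  → b + m ≡ c [mod 2 ]
  → e % (2 * q) ≡ (d + q * c) % (2 * q)
%2q-parity-shift q {d} {b} {c} {e} {m} e+mq≡d+qb b+m≡c = begin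
  e % (2 * q)                     ≡⟨ [m+kn]%n≡m%n e m (2 * q) ⟨
  (e + m * (2 * q)) % (2 * q)     ≡⟨ cong (_% (2 * q)) (+-*-Solver.solve 3
                                       (λ e m q → e :+ m :* (con 2 :* q) := (e :+ m :* q) :+ m :* q) refl e m q) ⟩
  (e + m * q + m * q) % (2 * q)   ≡⟨ %-+-congʳ (m * q) (2 * q) (≡[mod]⇒%≡ (2 * q) e+mq≡d+qb) ⟩
  (d + q * b + m * q) % (2 * q)   ≡⟨ cong (_% (2 * q)) (+-*-Solver.solve 4
                                       (λ d q b m → d :+ q :* b :+ m :* q := d :+ q :* (b :+ m)) refl d q b m) ⟩
  (d + q * (b + m)) % (2 * q)     ≡⟨ %-+-congˡ d (2 * q) (≡[mod]⇒%≡ (2 * q) (*-cong-≡[mod] q b+m≡c)) ⟩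
  (d + q * c) % (2 * q)           ∎
  where open +-*-Solver using (_:+_; _:*_; _:=_; con)
        open ≡-Reasoning

𝟙 : Bool → ℕ
𝟙 true  = 1
𝟙 false = 0

𝟙-∧ : ∀ x y → 𝟙 (x ∧ y) ≡ 𝟙 x * 𝟙 y
𝟙-∧ true  y = ≡.sym (+-identityʳ (𝟙 y))
𝟙-∧ false y = refl

∣p∣≡∑𝟙 : ∀ {n} (p : Subset n) → ∣ p ∣ ≡ ∑[ x < n ] 𝟙 (lookup p x)
∣p∣≡∑𝟙 []            = refl
∣p∣≡∑𝟙 (inside  ∷ p) = cong suc (∣p∣≡∑𝟙 p)
∣p∣≡∑𝟙 (outside ∷ p) = ∣p∣≡∑𝟙 p

∑𝟙-none : ∀ {t} (f : Fin t → Bool) → (∀ i → f i ≡ false) → ∑[ i < t ] 𝟙 (f i) ≡ 0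
∑𝟙-none {t} f none = trans (sum-cong-≗ (cong 𝟙 ∘ none)) (sum-replicate-zero t)

∑𝟙-unique : ∀ {t} (f : Fin t → Bool) {i} → f i ≡ true → (∀ j → j ≢ i → f j ≡ false)
  → ∑[ j < t ] 𝟙 (f j) ≡ 1
∑𝟙-unique f {zero}  fi others =
  cong₂ _+_ (cong 𝟙 fi) (∑𝟙-none (f ∘ suc) (λ j → others (suc j) λ ()))
∑𝟙-unique f {suc i} fi others =
  cong₂ _+_ (cong 𝟙 (others zero λ ())) (∑𝟙-unique (f ∘ suc) fi (λ j j≢i → others (suc j) (j≢i ∘ Fin.suc-injective)))

countIn≡∑𝟙 : ∀ {n t} (B : Fin t → Subset n) u → countIn B u ≡ ∑[ i < t ] 𝟙 (lookup (B i) u)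
countIn≡∑𝟙 B u = trans (∣p∣≡∑𝟙 (tabulate λ i → lookup (B i) u)) (sum-cong-≗ (cong 𝟙 ∘ lookup∘tabulate (λ i → lookup (B i) u)))

∉⇒lookup≡false : ∀ {n} {x : Fin n} {p : Subset n} → x ∉ p → lookup p x ≡ false
∉⇒lookup≡false {x = x} {p} x∉p with lookup p x in e
... | false = refl
... | true  = contradiction (lookup⇒[]= x p e) x∉p

lookup≡false⇒∉ : ∀ {n} {x : Fin n} {p : Subset n} → lookup p x ≡ false → x ∉ p
lookup≡false⇒∉ e x∈p = contradiction (trans (≡.sym e) ([]=⇒lookup x∈p)) λ ()

module _ {n} (G : Graph n) where

  deg≡∑𝟙 : ∀ S v → deg G S v ≡ ∑[ x < n ] 𝟙 (Adj G v x ∧ lookup S x)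
  deg≡∑𝟙 S v = trans (∣p∣≡∑𝟙 (N G v ∩ S)) (sum-cong-≗ (cong 𝟙 ∘ lookup-N∩S))
    where
    lookup-N∩S : ∀ x → lookup (N G v ∩ S) x ≡ Adj G v x ∧ lookup S x
    lookup-N∩S x = trans (lookup-zipWith _∧_ x (N G v) S) (cong (_∧ lookup S x) (lookup∘tabulate (Adj G v) x))

  deg<∣S∣ : ∀ {S v} → v ∈ S → deg G S v < ∣ S ∣
  deg<∣S∣ {S} {v} v∈S = p⊂q⇒∣p∣<∣q∣ (p∩q⊆q (N G v) S , v , v∈S , v∉N∩S)
    where
    v∉N∩S : v ∉ N G v ∩ S
    v∉N∩S v∈N∩S = lookup≡false⇒∉ (trans (lookup∘tabulate (Adj G v) v) (irrefl G v)) (proj₁ (x∈p∩q⁻ _ S v∈N∩S))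

  modular⇒regular : ∀ {m S} → Modular G m S → ∣ S ∣ ≤ m → Regular G S
  modular⇒regular mod ∣S∣≤m u v u∈S v∈S =
    ≡[mod]∧<⇒≡ (≤-trans (deg<∣S∣ u∈S) ∣S∣≤m) (≤-trans (deg<∣S∣ v∈S) ∣S∣≤m) (mod u v u∈S v∈S)

  module _ {U P Bᵢ : Subset n}
      (trace : ∀ x → x ∈ P → ∀ u → (u ∈ Bᵢ ⇔ (u ∈ U × Adj G x u ≡ true))) where

    adj≡trace : ∀ {x u} → x ∈ P → u ∈ U → Adj G u x ≡ lookup Bᵢ u
    adj≡trace {x} {u} x∈P u∈U with Adj G u x in a | lookup Bᵢ u in e
    ... | true  | true  = refl
    ... | false | false = refl
    ... | true  | false = contradiction (from (trace x x∈P u) (u∈U , trans (Graph.sym G x u) a)) (lookup≡false⇒∉ e)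
    ... | false | true  = contradiction
      (trans (≡.sym a) (trans (Graph.sym G u x) (proj₂ (to (trace x x∈P u) (lookup⇒[]= u Bᵢ e))))) λ ()

    deg-block : ∀ {u} → u ∈ U → deg G P u ≡ 𝟙 (lookup Bᵢ u) * ∣ P ∣
    deg-block {u} u∈U = begin
      deg G P u                                     ≡⟨ deg≡∑𝟙 P u ⟩
      ∑[ x < n ] 𝟙 (Adj G u x ∧ lookup P x)         ≡⟨ sum-cong-≗ (λ x → trans (cong 𝟙 (∧-trace x)) (𝟙-∧ (lookup Bᵢ u) (lookup P x))) ⟩
      ∑[ x < n ] (𝟙 (lookup Bᵢ u) * 𝟙 (lookup P x)) ≡⟨ *-distribˡ-sum (𝟙 (lookup Bᵢ u)) (𝟙 ∘ lookup P) ⟨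
      𝟙 (lookup Bᵢ u) * ∑[ x < n ] 𝟙 (lookup P x)   ≡⟨ cong (𝟙 (lookup Bᵢ u) *_) (∣p∣≡∑𝟙 P) ⟨
      𝟙 (lookup Bᵢ u) * ∣ P ∣                       ∎
      where
      open ≡-Reasoning
      ∧-trace : ∀ x → Adj G u x ∧ lookup P x ≡ lookup Bᵢ u ∧ lookup P x
      ∧-trace x with lookup P x in e
      ... | true  = cong (_∧ true) (adj≡trace (lookup⇒[]= x P e) u∈U)
      ... | false = trans (∧-zeroʳ _) (≡.sym (∧-zeroʳ _))

  module _ {t} {A U : Subset n} {P : Fin t → Subset n}
      (U⊆A : U ⊆ A)
      (disjoint : ∀ i j → i ≢ j → ∀ x → x ∈ P i → x ∈ P j → ⊥)
      (A∖U⇔⋃P : ∀ x → ((x ∈ A × x ∉ U) ⇔ ∃ λ i → x ∈ P i)) where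

    𝟙-partition : ∀ x → 𝟙 (lookup A x) ≡ 𝟙 (lookup U x) + ∑[ i < t ] 𝟙 (lookup (P i) x)
    𝟙-partition x with lookup U x in eU | lookup A x in eA
    ... | true  | true  = cong suc (≡.sym (∑𝟙-none _ λ i → ∉⇒lookup≡false λ x∈Pᵢ →
                            proj₂ (from (A∖U⇔⋃P x) (i , x∈Pᵢ)) (lookup⇒[]= x U eU)))
    ... | true  | false = contradiction (U⊆A (lookup⇒[]= x U eU)) (lookup≡false⇒∉ eA)
    ... | false | false = ≡.sym (∑𝟙-none _ λ i → ∉⇒lookup≡false λ x∈Pᵢ →
                            lookup≡false⇒∉ eA (proj₁ (from (A∖U⇔⋃P x) (i , x∈Pᵢ))))
    ... | false | true  with to (A∖U⇔⋃P x) (lookup⇒[]= x A eA , lookup≡false⇒∉ eU)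
    ...   | i , x∈Pᵢ = ≡.sym (∑𝟙-unique _ ([]=⇒lookup x∈Pᵢ) λ j j≢i →
                         ∉⇒lookup≡false λ x∈Pⱼ → disjoint j i j≢i x x∈Pⱼ x∈Pᵢ)

    deg-partition : ∀ u → deg G A u ≡ deg G U u + ∑[ i < t ] deg G (P i) u
    deg-partition u = begin
      deg G A u                                                    ≡⟨ deg≡∑𝟙 A u ⟩
      ∑[ x < n ] 𝟙 (Adj G u x ∧ lookup A x)                        ≡⟨ sum-cong-≗ (λ x → 𝟙-∧-partition (Adj G u x) x) ⟩
      ∑[ x < n ] (𝟙 (Adj G u x ∧ lookup U x) + ∑[ i < t ] 𝟙 (Adj G u x ∧ lookup (P i) x))
                                                                   ≡⟨ ∑-distrib-+ (λ x → 𝟙 (Adj G u x ∧ lookup U x)) _ ⟩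
      ∑[ x < n ] 𝟙 (Adj G u x ∧ lookup U x) + ∑[ x < n ] ∑[ i < t ] 𝟙 (Adj G u x ∧ lookup (P i) x)
                                                                   ≡⟨ cong₂ _+_ (≡.sym (deg≡∑𝟙 U u))
                                                                        (∑-comm (λ x i → 𝟙 (Adj G u x ∧ lookup (P i) x))) ⟩
      deg G U u + ∑[ i < t ] ∑[ x < n ] 𝟙 (Adj G u x ∧ lookup (P i) x)
                                                                   ≡⟨ cong (deg G U u +_) (sum-cong-≗ λ i → deg≡∑𝟙 (P i) u) ⟨
      deg G U u + ∑[ i < t ] deg G (P i) u                         ∎
      where
      open ≡-Reasoning
      𝟙-∧-partition : ∀ y x → 𝟙 (y ∧ lookup A x) ≡ 𝟙 (y ∧ lookup U x) + ∑[ i < t ] 𝟙 (y ∧ lookup (P i) x)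
      𝟙-∧-partition true  x = 𝟙-partition x
      𝟙-∧-partition false x = ≡.sym (sum-replicate-zero t)

    module _ {q} {B : Fin t → Subset n}
        (∣Pᵢ∣≡q : ∀ i → ∣ P i ∣ ≡ q)
        (trace : ∀ i x → x ∈ P i → ∀ u → (u ∈ B i ⇔ (u ∈ U × Adj G x u ≡ true))) where

      deg≡deg+countIn*q : ∀ {u} → u ∈ U → deg G A u ≡ deg G U u + countIn B u * q
      deg≡deg+countIn*q {u} u∈U = begin
        deg G A u                                         ≡⟨ deg-partition u ⟩
        deg G U u + ∑[ i < t ] deg G (P i) u              ≡⟨ cong (deg G U u +_) (sum-cong-≗ deg-Pᵢ) ⟩
        deg G U u + ∑[ i < t ] (𝟙 (lookup (B i) u) * q)   ≡⟨ cong (deg G U u +_) (*-distribʳ-sum q (λ i → 𝟙 (lookup (B i) u))) ⟨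
        deg G U u + (∑[ i < t ] 𝟙 (lookup (B i) u)) * q   ≡⟨ cong (λ r → deg G U u + r * q) (countIn≡∑𝟙 B u) ⟨
        deg G U u + countIn B u * q                       ∎
        where
        open ≡-Reasoning
        deg-Pᵢ : ∀ i → deg G (P i) u ≡ 𝟙 (lookup (B i) u) * q
        deg-Pᵢ i = trans (deg-block (trace i) u∈U) (cong (𝟙 (lookup (B i) u) *_) (∣Pᵢ∣≡q i))

mainTheorem14 : ∀ {n} (G : Graph n) (k : ℕ) (A : Subset n)
    → Modular G (2 ^ k) A
    → (d : ℕ) → d < 2 * 2 ^ k
    → (b : Fin n → ℕ)
    → (∀ v → v ∈ A → b v ≤ 1)
    → (∀ v → v ∈ A → deg G A v ≡ (d + 2 ^ k * b v) [mod 2 * 2 ^ k ])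
    → (U : Subset n) → U ⊆ A
    → (t : ℕ) (P : Fin t → Subset n) (B : Fin t → Subset n)
    → (∀ i j → i ≢ j → ∀ x → x ∈ P i → x ∈ P j → ⊥)
    → (∀ x → ((x ∈ A × x ∉ U) ⇔ ∃ λ i → x ∈ P i))
    → (∀ i → ∣ P i ∣ ≡ 2 ^ k)
    → (∀ i x → x ∈ P i → ∀ u → (u ∈ B i ⇔ (u ∈ U × Adj G x u ≡ true)))
    → (Σ ℕ λ c → ∀ u → u ∈ U → (b u + countIn B u) ≡ c [mod 2 ])
    → Modular G (2 * 2 ^ k) U × (∣ U ∣ ≤ 2 * 2 ^ k → Regular G U)
mainTheorem14 G k A _ d _ b _ degA≡d+qb U U⊆A t P B disjoint A∖U⇔⋃P ∣Pᵢ∣≡q trace (c , parity) =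
  modular , modular⇒regular G modular
  where
  q = 2 ^ k
  instance
    2q≢0 : NonZero (2 * q)
    2q≢0 = m^n≢0 2 (suc k)

  degU≡d+qc : ∀ {u} → u ∈ U → deg G U u % (2 * q) ≡ (d + q * c) % (2 * q)
  degU≡d+qc {u} u∈U = %2q-parity-shift q
    (subst (_≡ d + q * b u [mod 2 * q ]) (deg≡deg+countIn*q G U⊆A disjoint A∖U⇔⋃P ∣Pᵢ∣≡q trace u∈U)
           (degA≡d+qb u (U⊆A u∈U)))
    (parity u u∈U)

  modular : Modular G (2 * q) U
  modular u v u∈U v∈U = %≡⇒≡[mod] (2 * q) (trans (degU≡d+qc u∈U) (≡.sym (degU≡d+qc v∈U)))
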